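{- Let $G$ be a finite simple bipartite graph with bipartition $(X,Y)$, on $n$ vertices, with biclique number $t$. Then $\varphi(G)\leq \left\lfloor \frac{n-t+4}{2}\right\rfloor$.
   Context: A biclique of $G$ is a subgraph of $G$ that is a complete bipartite graph (a single vertex being regarded as a complete bipartite graph with one side empty). The biclique number of $G$ is the minimum number of mutually vertex-disjoint bicliques of $G$ covering all vertices of $G$. A $b$-coloring of $G$ with $b$ colors is a proper coloring of $V(G)$ using exactly $b$ colors such that for every color $i$ there is a vertex of color $i$ having neighbors of all the other $b-1$ colors. The $b$-chromatic number $\varphi(G)$ is the largest $b$ for which such a coloring exists. -}

module Defs where

open import Data.Nat using (ℕ; _≤_)
open import Data.Fin using (Fin)
open import Data.Bool using (Bool; true; false)
open import Data.Product using (Σ; ∃; _×_; _,_)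
open import Data.Sum using (_⊎_)
open import Relation.Nullary using (¬_)
open import Relation.Binary.PropositionalEquality using (_≡_; _≢_)

record Graph (n : ℕ) : Set₁ where
  field
    Adj   : Fin n → Fin n → Set
    sym   : ∀ {u v} → Adj u v → Adj v u
    irrefl : ∀ {v} → ¬ Adj v v

open Graph public

-- (X , Y) is a bipartition of G, encoded by part : Fin n → Bool
-- (X = vertices with part true, Y = vertices with part false):
-- every edge joins X to Y.
IsBipartition : ∀ {n} → Graph n → (Fin n → Bool) → Set
IsBipartition G part = ∀ u v → Adj G u v → part u ≢ part v

-- Vertex v lies in biclique  block v , on side  side v  of it.
-- Each block i is a biclique: either a single vertex (one side empty),
-- or both sides nonempty and every vertex of one side adjacent to
-- every vertex of the other side (complete bipartite subgraph).
record BicliqueCover {n : ℕ} (G : Graph n) (k : ℕ) : Set where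
  field
    block : Fin n → Fin k
    side  : Fin n → Bool
    isBiclique : ∀ (i : Fin k) →
      (Σ (Fin n) λ v → block v ≡ i × (∀ u → block u ≡ i → u ≡ v))
      ⊎ ((Σ (Fin n) λ u → block u ≡ i × side u ≡ true)
         × (Σ (Fin n) λ v → block v ≡ i × side v ≡ false)
         × (∀ u v → block u ≡ i → block v ≡ i →
                side u ≡ true → side v ≡ false → Adj G u v))

IsBicliqueNumber : ∀ {n} → Graph n → ℕ → Set
IsBicliqueNumber G t = BicliqueCover G t × (∀ k → BicliqueCover G k → t ≤ k)

record BColoring {n : ℕ} (G : Graph n) (b : ℕ) : Set where
  field
    col    : Fin n → Fin b
    proper : ∀ u v → Adj G u v → col u ≢ col v
    onto   : ∀ (i : Fin b) → ∃ λ v → col v ≡ i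
    dominating : ∀ (i : Fin b) → Σ (Fin n) λ v → col v ≡ i ×
                   (∀ (j : Fin b) → j ≢ i → ∃ λ w → Adj G v w × col w ≡ j)

{-# OPTIONS --safe #-}
-- Fix the dominating vertex d₀ of colour 0 and a second colour j. For each of
-- the b − 2 remaining colours c pick two "pendant" vertices of colour c: the
-- neighbour of d₀ of colour c, and a vertex of colour c on the side of d₀ with
-- a neighbour coloured 0 or j (the neighbour of colour c of d_j when d_j lies
-- across from d₀; otherwise all dominating vertices lie on d₀'s side and d_c
-- itself will do). These 2(b − 2) vertices are distinct and none is coloured
-- 0 or j, so hanging each on its neighbour coloured 0 or j partitions V(G)
-- into stars centred at the remaining n − 2(b − 2) vertices: t ≤ n − 2(b − 2).
module Submission where

open import Defs
open import Data.Bool as Bool using (Bool; true; false)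
open import Data.Bool.Properties using (¬-not)
open import Data.Empty using (⊥-elim)
open import Data.Fin using (Fin; zero; suc; _≟_; splitAt; join; punchIn)
open import Data.Fin.Properties
  using (any?; all?; injective⇒≤; join-splitAt; suc-injective; punchIn-injective; punchInᵢ≢i; ¬∀⟶∃¬)
open import Data.List using (List; length; lookup; filter; allFin)
open import Data.List.Membership.Propositional using (_∈_)
open import Data.List.Membership.Propositional.Properties using (∈-filter⁺; ∈-allFin; ∈-lookup)
import Data.List.Relation.Unary.All as All
open import Data.List.Relation.Unary.All.Properties using (all-filter)
open import Data.List.Relation.Unary.AllPairs using (_∷_)
open import Data.List.Relation.Unary.Any using (index)
open import Data.List.Relation.Unary.Any.Properties using (lookup-index)
open import Data.List.Relation.Unary.Unique.Propositional using (Unique)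
import Data.List.Relation.Unary.Unique.Propositional.Properties as Unique
open import Data.Nat using (ℕ; suc; _≤_; _+_; _∸_; _*_; z≤n; s≤s)
open import Data.Nat.DivMod using (_/_; /-monoˡ-≤; m*n/n≡m)
open import Data.Nat.Properties
  using (≤-trans; +-monoˡ-≤; +-monoʳ-≤; m+n≤o⇒m≤o∸n; module ≤-Reasoning)
open import Data.Nat.Tactic.RingSolver using (solve-∀)
open import Data.Product using (∃; _×_; _,_; proj₁; proj₂)
open import Data.Sum using (_⊎_; inj₁; inj₂; [_,_]′)
open import Function using (_∘_)
open import Function.Definitions using (Injective)
open import Relation.Nullary using (¬_; Dec; yes; no; does; ¬?)
open import Relation.Binary.PropositionalEquality
  using (_≡_; _≢_; refl; trans; cong; subst; module ≡-Reasoning)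
  renaming (sym to ≡-sym)

lookup-injective : ∀ {A : Set} {xs : List A} → Unique xs → Injective _≡_ _≡_ (lookup xs)
lookup-injective (_ ∷ _)    {zero}  {zero}  _  = refl
lookup-injective (x∉ ∷ _)   {zero}  {suc j} eq = ⊥-elim (All.lookup x∉ (∈-lookup j) eq)
lookup-injective (x∉ ∷ _)   {suc i} {zero}  eq = ⊥-elim (All.lookup x∉ (∈-lookup i) (≡-sym eq))
lookup-injective (_ ∷ uniq) {suc i} {suc j} eq = cong suc (lookup-injective uniq eq)

splitAt-injective : ∀ m {n} → Injective _≡_ _≡_ (splitAt m {n})
splitAt-injective m {n} {x} {y} eq = begin
  x                      ≡⟨ join-splitAt m n x ⟨
  join m n (splitAt m x) ≡⟨ cong (join m n) eq ⟩
  join m n (splitAt m y) ≡⟨ join-splitAt m n y ⟩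
  y                      ∎
  where open ≡-Reasoning

⊎-injective⇒+≤ : ∀ {k ℓ n} {f : Fin k ⊎ Fin ℓ → Fin n} → Injective _≡_ _≡_ f → k + ℓ ≤ n
⊎-injective⇒+≤ {k} f-inj = injective⇒≤ (splitAt-injective k ∘ f-inj)

module PendantCover {n ℓ : ℕ} (G : Graph n) (leaf centre : Fin ℓ → Fin n)
  (leaf-injective : Injective _≡_ _≡_ leaf)
  (centre≢leaf : ∀ x y → centre x ≢ leaf y)
  (leaf-adj-centre : ∀ x → Adj G (leaf x) (centre x)) where

  IsLeaf : Fin n → Set
  IsLeaf v = ∃ λ x → leaf x ≡ v

  isLeaf? : ∀ v → Dec (IsLeaf v)
  isLeaf? v = any? (λ x → leaf x ≟ v)

  roots : List (Fin n)
  roots = filter (¬? ∘ isLeaf?) (allFin n)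

  root : Fin (length roots) → Fin n
  root = lookup roots

  root-injective : Injective _≡_ _≡_ root
  root-injective = lookup-injective (Unique.filter⁺ (¬? ∘ isLeaf?) (Unique.allFin⁺ n))

  root-¬leaf : ∀ i → ¬ IsLeaf (root i)
  root-¬leaf i = All.lookup (all-filter (¬? ∘ isLeaf?) (allFin n)) (∈-lookup i)

  anchor : Fin n → Fin n
  anchor v with isLeaf? v
  ... | yes (x , _) = centre x
  ... | no _        = v

  anchor-¬leaf : ∀ v → ¬ IsLeaf (anchor v)
  anchor-¬leaf v with isLeaf? v
  ... | yes (x , _) = λ (y , eq) → centre≢leaf x y (≡-sym eq)
  ... | no v-¬leaf  = v-¬leaf

  anchor-fixes-¬leaf : ∀ {v} → ¬ IsLeaf v → anchor v ≡ v
  anchor-fixes-¬leaf {v} v-¬leaf with isLeaf? v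
  ... | yes v-leaf = ⊥-elim (v-¬leaf v-leaf)
  ... | no _       = refl

  leaf-adj-anchor : ∀ {v} → IsLeaf v → Adj G v (anchor v)
  leaf-adj-anchor (x , refl) with isLeaf? (leaf x)
  ... | yes (y , eq) = subst (λ u → Adj G u (centre y)) eq (leaf-adj-centre y)
  ... | no ¬leaf     = ⊥-elim (¬leaf (x , refl))

  anchor∈roots : ∀ v → anchor v ∈ roots
  anchor∈roots v = ∈-filter⁺ (¬? ∘ isLeaf?) (∈-allFin (anchor v)) (anchor-¬leaf v)

  block : Fin n → Fin (length roots)
  block v = index (anchor∈roots v)

  anchor≡root-block : ∀ v → anchor v ≡ root (block v)
  anchor≡root-block v = lookup-index (anchor∈roots v)

  block-root : ∀ i → block (root i) ≡ i
  block-root i = root-injective (begin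
    root (block (root i)) ≡⟨ anchor≡root-block (root i) ⟨
    anchor (root i)       ≡⟨ anchor-fixes-¬leaf (root-¬leaf i) ⟩
    root i                ∎)
    where open ≡-Reasoning

  ¬leaf∈block⇒≡root : ∀ {v i} → ¬ IsLeaf v → block v ≡ i → v ≡ root i
  ¬leaf∈block⇒≡root {v} v-¬leaf refl = trans (≡-sym (anchor-fixes-¬leaf v-¬leaf)) (anchor≡root-block v)

  side : Fin n → Bool
  side v = does (isLeaf? v)

  side-true : ∀ {v} → side v ≡ true → IsLeaf v
  side-true {v} eq with isLeaf? v
  ... | yes v-leaf = v-leaf

  side-false : ∀ {v} → side v ≡ false → ¬ IsLeaf v
  side-false {v} eq with isLeaf? v
  ... | no v-¬leaf = v-¬leaf

  side-leaf : ∀ x → side (leaf x) ≡ true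
  side-leaf x with isLeaf? (leaf x)
  ... | yes _     = refl
  ... | no ¬leaf  = ⊥-elim (¬leaf (x , refl))

  side-root : ∀ i → side (root i) ≡ false
  side-root i with isLeaf? (root i)
  ... | yes leaf  = ⊥-elim (root-¬leaf i leaf)
  ... | no _      = refl

  -- Block i is the star centred at root i; its leaves form the true side.
  star-cover : BicliqueCover G (length roots)
  star-cover = record { block = block ; side = side ; isBiclique = star }
    where
    star : ∀ i → _
    star i with any? (λ x → block (leaf x) ≟ i)
    ... | yes (x , x∈i) = inj₂ ((leaf x , x∈i , side-leaf x) , (root i , block-root i , side-root i) , adj)
      where
      adj : ∀ u v → block u ≡ i → block v ≡ i → side u ≡ true → side v ≡ false → Adj G u v
      adj u v u∈i v∈i u-leaf v-¬leaf = subst (Adj G u) anchor-u≡v (leaf-adj-anchor (side-true u-leaf))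
        where
        open ≡-Reasoning
        anchor-u≡v : anchor u ≡ v
        anchor-u≡v = begin
          anchor u       ≡⟨ anchor≡root-block u ⟩
          root (block u) ≡⟨ cong root u∈i ⟩
          root i         ≡⟨ ¬leaf∈block⇒≡root (side-false v-¬leaf) v∈i ⟨
          v              ∎
    ... | no no-leaf = inj₁ (root i , block-root i , λ u u∈i →
            ¬leaf∈block⇒≡root (λ { (x , refl) → no-leaf (x , u∈i) }) u∈i)

  leaves+roots≤n : ℓ + length roots ≤ n
  leaves+roots≤n = ⊎-injective⇒+≤ {f = [ leaf , root ]′} injective
    where
    injective : Injective _≡_ _≡_ [ leaf , root ]′
    injective {inj₁ x} {inj₁ y} eq = cong inj₁ (leaf-injective eq)
    injective {inj₁ x} {inj₂ j} eq = ⊥-elim (root-¬leaf j (x , eq))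
    injective {inj₂ i} {inj₁ y} eq = ⊥-elim (root-¬leaf i (y , ≡-sym eq))
    injective {inj₂ i} {inj₂ j} eq = cong inj₂ (root-injective eq)

  pendant-cover : ∃ λ k → BicliqueCover G k × ℓ + k ≤ n
  pendant-cover = length roots , star-cover , leaves+roots≤n

module DominatingPendants {n : ℕ} {G : Graph n} {part : Fin n → Bool} (bip : IsBipartition G part)
  {m : ℕ} (C : BColoring G (2 + m)) where
  open BColoring C

  dom : Fin (2 + m) → Fin n
  dom c = proj₁ (dominating c)

  col-dom : ∀ c → col (dom c) ≡ c
  col-dom c = proj₁ (proj₂ (dominating c))

  nbr : ∀ c c′ → c′ ≢ c → Fin n
  nbr c c′ c′≢c = proj₁ (proj₂ (proj₂ (dominating c)) c′ c′≢c)

  dom-adj-nbr : ∀ c c′ c′≢c → Adj G (dom c) (nbr c c′ c′≢c)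
  dom-adj-nbr c c′ c′≢c = proj₁ (proj₂ (proj₂ (proj₂ (dominating c)) c′ c′≢c))

  col-nbr : ∀ c c′ c′≢c → col (nbr c c′ c′≢c) ≡ c′
  col-nbr c c′ c′≢c = proj₂ (proj₂ (proj₂ (proj₂ (dominating c)) c′ c′≢c))

  part-nbr : ∀ c c′ c′≢c → part (nbr c c′ c′≢c) ≢ part (dom c)
  part-nbr c c′ c′≢c eq = bip _ _ (dom-adj-nbr c c′ c′≢c) (≡-sym eq)

  module _ (j : Fin (suc m)) where

    other : Fin m → Fin (2 + m)
    other x = suc (punchIn j x)

    other-injective : Injective _≡_ _≡_ other
    other-injective = punchIn-injective j _ _ ∘ suc-injective

    other≢zero : ∀ x → other x ≢ zero
    other≢zero x ()

    other≢suc : ∀ x → other x ≢ suc j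
    other≢suc x = punchInᵢ≢i j x ∘ suc-injective

    module _ (alongside hook : Fin m → Fin n)
      (col-alongside : ∀ x → col (alongside x) ≡ other x)
      (part-alongside : ∀ x → part (alongside x) ≡ part (dom zero))
      (alongside-adj-hook : ∀ x → Adj G (alongside x) (hook x))
      (col-hook : ∀ x → col (hook x) ≡ zero ⊎ col (hook x) ≡ suc j) where

      across : Fin m → Fin n
      across x = nbr zero (other x) (other≢zero x)

      leaf : Fin m ⊎ Fin m → Fin n
      leaf = [ across , alongside ]′

      centre : Fin m ⊎ Fin m → Fin n
      centre = [ (λ _ → dom zero) , hook ]′

      col-leaf : ∀ l → ∃ λ x → col (leaf l) ≡ other x
      col-leaf (inj₁ x) = x , col-nbr zero (other x) (other≢zero x)
      col-leaf (inj₂ x) = x , col-alongside x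

      col-centre : ∀ l → col (centre l) ≡ zero ⊎ col (centre l) ≡ suc j
      col-centre (inj₁ _) = inj₁ (col-dom zero)
      col-centre (inj₂ x) = col-hook x

      centre≢leaf : ∀ l l′ → centre l ≢ leaf l′
      centre≢leaf l l′ eq with col-leaf l′ | col-centre l
      ... | x , col-l′ | inj₁ col-l = other≢zero x (trans (≡-sym col-l′) (trans (cong col (≡-sym eq)) col-l))
      ... | x , col-l′ | inj₂ col-l = other≢suc x (trans (≡-sym col-l′) (trans (cong col (≡-sym eq)) col-l))

      across≢alongside : ∀ x y → across x ≢ alongside y
      across≢alongside x y eq = part-nbr zero (other x) (other≢zero x) (trans (cong part eq) (part-alongside y))

      leaf-injective : Injective _≡_ _≡_ leaf
      leaf-injective {inj₁ x} {inj₁ y} eq = cong inj₁ (other-injective (begin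
        other x        ≡⟨ col-nbr zero (other x) (other≢zero x) ⟨
        col (across x) ≡⟨ cong col eq ⟩
        col (across y) ≡⟨ col-nbr zero (other y) (other≢zero y) ⟩
        other y        ∎))
        where open ≡-Reasoning
      leaf-injective {inj₁ x} {inj₂ y} eq = ⊥-elim (across≢alongside x y eq)
      leaf-injective {inj₂ x} {inj₁ y} eq = ⊥-elim (across≢alongside y x (≡-sym eq))
      leaf-injective {inj₂ x} {inj₂ y} eq = cong inj₂ (other-injective (begin
        other x           ≡⟨ col-alongside x ⟨
        col (alongside x) ≡⟨ cong col eq ⟩
        col (alongside y) ≡⟨ col-alongside y ⟩
        other y           ∎))
        where open ≡-Reasoning

      leaf-adj-centre : ∀ l → Adj G (leaf l) (centre l)
      leaf-adj-centre (inj₁ x) = sym G (dom-adj-nbr zero (other x) (other≢zero x))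
      leaf-adj-centre (inj₂ x) = alongside-adj-hook x

      pendant-cover : ∃ λ k → BicliqueCover G k × (m + m) + k ≤ n
      pendant-cover = PendantCover.pendant-cover G (leaf ∘ splitAt m) (centre ∘ splitAt m)
        (splitAt-injective m ∘ leaf-injective)
        (λ x y → centre≢leaf (splitAt m x) (splitAt m y))
        (leaf-adj-centre ∘ splitAt m)

  same-side-cover : (∀ j → part (dom (suc j)) ≡ part (dom zero)) →
                    ∃ λ k → BicliqueCover G k × (m + m) + k ≤ n
  same-side-cover same-side = pendant-cover zero (dom ∘ other zero) (λ x → nbr (other zero x) zero λ ())
    (col-dom ∘ other zero) (same-side ∘ punchIn zero)
    (λ x → dom-adj-nbr (other zero x) zero λ ())
    (λ x → inj₁ (col-nbr (other zero x) zero λ ()))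

  across-cover : ∀ j → part (dom (suc j)) ≢ part (dom zero) →
                 ∃ λ k → BicliqueCover G k × (m + m) + k ≤ n
  across-cover j across = pendant-cover j
    (λ x → nbr (suc j) (other j x) (other≢suc j x)) (λ _ → dom (suc j))
    (λ x → col-nbr (suc j) (other j x) (other≢suc j x))
    (λ x → trans (¬-not (part-nbr (suc j) (other j x) (other≢suc j x))) (≡-sym (¬-not (across ∘ ≡-sym))))
    (λ x → sym G (dom-adj-nbr (suc j) (other j x) (other≢suc j x)))
    (λ _ → inj₂ (col-dom (suc j)))

  same-side? : ∀ j → Dec (part (dom (suc j)) ≡ part (dom zero))
  same-side? j = part (dom (suc j)) Bool.≟ part (dom zero)

  bcoloring-cover : ∃ λ k → BicliqueCover G k × (m + m) + k ≤ n
  bcoloring-cover with all? same-side?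
  ... | yes same-side = same-side-cover same-side
  ... | no ¬same-side = let j , across = ¬∀⟶∃¬ _ _ same-side? ¬same-side in across-cover j across

two+m≤[x+4]/2 : ∀ {m x} → m + m ≤ x → 2 + m ≤ (x + 4) / 2
two+m≤[x+4]/2 {m} {x} m+m≤x = begin
  2 + m             ≡⟨ m*n/n≡m (2 + m) 2 ⟨
  (2 + m) * 2 / 2   ≡⟨ cong (_/ 2) (double m) ⟩
  (m + m + 4) / 2   ≤⟨ /-monoˡ-≤ 2 (+-monoˡ-≤ 4 m+m≤x) ⟩
  (x + 4) / 2       ∎
  where
  open ≤-Reasoning
  double : ∀ m → (2 + m) * 2 ≡ m + m + 4
  double = solve-∀

theorem4 : ∀ (n : ℕ) (G : Graph n) (part : Fin n → Bool) (t : ℕ) →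
    IsBipartition G part → IsBicliqueNumber G t →
    ∀ (b : ℕ) → BColoring G b → b ≤ (n ∸ t + 4) / 2
theorem4 n G part t bip _ 0 C = z≤n
theorem4 n G part t bip _ 1 C = ≤-trans (s≤s z≤n) (two+m≤[x+4]/2 {0} {n ∸ t} z≤n)
theorem4 n G part t bip (_ , minimal) (suc (suc m)) C
  with k , cover , 2m+k≤n ← DominatingPendants.bcoloring-cover bip C =
  two+m≤[x+4]/2 (m+n≤o⇒m≤o∸n (m + m) (begin
    m + m + t ≤⟨ +-monoʳ-≤ (m + m) (minimal k cover) ⟩
    m + m + k ≤⟨ 2m+k≤n ⟩
    n         ∎))
  where open ≤-Reasoning
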